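{- For integers $n,k$ with $n\ge 2$ and $2\le k\le 2^{n-1}$, $\sigma_{n,k}+\sigma_{n,k-1}=\tau_{n,k}$.
   Context: A bipartition of a set $S$ is a partition of $S$ into at most two nonempty components; it is proper if it has exactly two components (the only non-proper bipartition is $\{S\}$). A bipartition cuts two elements if they lie in different components. A family of bipartitions of $S$ is a separating family for $S$ if every two distinct elements of $S$ are cut by some bipartition in the family. $\tau_{n,k}$ is the number of separating families consisting of $k$ distinct arbitrary bipartitions of a fixed $n$-element set, and $\sigma_{n,k}$ the number of separating families consisting of $k$ distinct proper bipartitions of a fixed $n$-element set. -}

module Defs where

open import Data.Bool using (Bool; true; false)
import Data.Bool.Properties as BoolP
open import Data.Nat using (ℕ; zero; suc)
open import Data.Fin using (Fin; zero; suc)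
open import Data.Fin.Properties using (all?)
open import Data.Vec using (Vec; []; _∷_; lookup; replicate)
open import Data.Vec.Properties using (≡-dec)
open import Data.List using (List; []; _∷_; [_]; _++_; map; concatMap; filter; length)
open import Data.List.Relation.Unary.Any using (Any; any?)
open import Relation.Nullary using (¬_; Dec; ¬?)
open import Relation.Nullary.Decidable using (_→-dec_)
open import Relation.Binary.PropositionalEquality using (_≡_; _≢_)

-- A bipartition of Fin (suc m) = {0,…,m}.  A partition into at most two
-- nonempty blocks is the same as a 2-colouring up to swapping colours; we
-- use the canonical representative in which element 0 has colour false.
-- Such a bipartition is thus determined by the colours of elements 1..m.
Bip : ℕ → Set
Bip m = Vec Bool m

colour : ∀ {m} → Bip m → Fin (suc m) → Bool
colour b zero    = false
colour b (suc i) = lookup b i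

trivial : ∀ m → Bip m
trivial m = replicate m false

Proper : ∀ {m} → Bip m → Set
Proper {m} b = ¬ (b ≡ trivial m)

proper? : ∀ {m} (b : Bip m) → Dec (Proper b)
proper? {m} b = ¬? (≡-dec BoolP._≟_ b (trivial m))

Cuts : ∀ {m} → Bip m → Fin (suc m) → Fin (suc m) → Set
Cuts b i j = colour b i ≢ colour b j

Separating : ∀ {m} → List (Bip m) → Set
Separating {m} fam = ∀ (i j : Fin (suc m)) → i ≢ j → Any (λ b → Cuts b i j) fam

separating? : ∀ {m} (fam : List (Bip m)) → Dec (Separating fam)
separating? {m} fam =
  all? λ i → all? λ j →
    (¬? (i Data.Fin.≟ j)) →-dec
      any? (λ b → ¬? (colour b i BoolP.≟ colour b j)) fam

allVecs : ∀ m → List (Vec Bool m)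
allVecs zero    = [ [] ]
allVecs (suc m) = concatMap (λ v → (false ∷ v) ∷ (true ∷ v) ∷ []) (allVecs m)

allBips : ∀ m → List (Bip m)
allBips m = allVecs m

properBips : ∀ m → List (Bip m)
properBips m = filter proper? (allBips m)

-- all k-element sub-families of a list (sublists of length k);
-- for a duplicate-free list these are exactly the k-element subsets, each once
choose : ∀ {A : Set} → ℕ → List A → List (List A)
choose zero    _        = [ [] ]
choose (suc k) []       = []
choose (suc k) (x ∷ xs) = map (x ∷_) (choose k xs) ++ choose (suc k) xs

τ : ℕ → ℕ → ℕ
τ zero    k = 0   -- irrelevant convention (n = 0 is never used)
τ (suc m) k = length (filter separating? (choose k (allBips m)))

σ : ℕ → ℕ → ℕ
σ zero    k = 0   -- irrelevant convention (n = 0 is never used)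
σ (suc m) k = length (filter separating? (choose k (properBips m)))

-- A family of k proper bipartitions is a family of k arbitrary bipartitions
-- avoiding {S}; a family containing {S} is {S} together with k - 1 proper
-- bipartitions.  Since {S} cuts nothing, adding or removing it does not affect
-- separation, so τ_{n,k} = σ_{n,k} + σ_{n,k-1}.
module Submission where

open import Defs
open import Data.Nat using (ℕ; suc; _+_; _∸_; _^_; _≤_)
open import Data.Nat.Properties using (+-comm)
open import Data.Bool using (Bool; true; false)
open import Data.Vec using (_∷_)
open import Data.Vec.Properties using (∷-injectiveʳ; lookup-replicate)
open import Data.Fin using (Fin; zero; suc)
open import Data.List using (List; []; _∷_; _++_; map; filter; length; concatMap)
open import Data.List.Properties
  using (length-map; length-++; filter-++; filter-≐; filter-reject; filter-all)
open import Data.List.Relation.Unary.All as All using (All; []; _∷_)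
open import Data.List.Relation.Unary.All.Properties using (all-filter; concat⁺; map⁺)
open import Data.List.Relation.Unary.Any using (here; there)
open import Data.Product using (_,_)
open import Data.Empty using (⊥-elim)
open import Function using (_∘_)
open import Relation.Nullary using (does)
open import Relation.Unary using (Pred; Decidable; _≐_)
open import Relation.Binary.PropositionalEquality using (_≡_; refl; sym; trans; cong; module ≡-Reasoning)

open ≡-Reasoning

module _ {a b p} {A : Set a} {B : Set b} {P : Pred B p}
         (P? : Decidable P) where

  filter-map : ∀ (f : A → B) xs → filter P? (map f xs) ≡ map f (filter (P? ∘ f) xs)
  filter-map f []       = refl
  filter-map f (x ∷ xs) with does (P? (f x))
  ... | true  = cong (f x ∷_) (filter-map f xs)
  ... | false = filter-map f xs

  length-filter-map : ∀ {q} {Q : Pred A q} (Q? : Decidable Q) (f : A → B) → P ∘ f ≐ Q → ∀ xs →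
    length (filter P? (map f xs)) ≡ length (filter Q? xs)
  length-filter-map Q? f Pf≐Q xs = begin
    length (filter P? (map f xs))       ≡⟨ cong length (filter-map f xs) ⟩
    length (map f (filter (P? ∘ f) xs)) ≡⟨ length-map f (filter (P? ∘ f) xs) ⟩
    length (filter (P? ∘ f) xs)         ≡⟨ cong length (filter-≐ (P? ∘ f) Q? Pf≐Q xs) ⟩
    length (filter Q? xs)               ∎

Proper-∷ : ∀ {m} (c : Bool) {v : Bip m} → Proper v → Proper (c ∷ v)
Proper-∷ c v≢trivial = v≢trivial ∘ ∷-injectiveʳ

allBips≡trivial∷properBips : ∀ m → allBips m ≡ trivial m ∷ properBips m
allBips≡trivial∷properBips 0 = refl
allBips≡trivial∷properBips (suc m) = begin
  allBips (suc m)                                          ≡⟨ unfold ⟩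
  trivial (suc m) ∷ rest                                   ≡⟨ cong (trivial (suc m) ∷_) (sym filter-rest) ⟩
  trivial (suc m) ∷ filter proper? (trivial (suc m) ∷ rest) ≡⟨ cong (λ xs → trivial (suc m) ∷ filter proper? xs) (sym unfold) ⟩
  trivial (suc m) ∷ properBips (suc m)                     ∎
  where
  extend : Bip m → List (Bip (suc m))
  extend v = (false ∷ v) ∷ (true ∷ v) ∷ []

  rest : List (Bip (suc m))
  rest = (true ∷ trivial m) ∷ concatMap extend (properBips m)

  unfold : allBips (suc m) ≡ trivial (suc m) ∷ rest
  unfold = cong (concatMap extend) (allBips≡trivial∷properBips m)

  rest-proper : All Proper rest
  rest-proper = (λ ()) ∷ concat⁺ (map⁺ (All.map extend-proper (all-filter proper? (allBips m))))
    where
    extend-proper : ∀ {v} → Proper v → All Proper (extend v)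
    extend-proper v-proper = Proper-∷ false v-proper ∷ Proper-∷ true v-proper ∷ []

  filter-rest : filter proper? (trivial (suc m) ∷ rest) ≡ rest
  filter-rest = trans (filter-reject proper? (λ trivial-proper → trivial-proper refl))
                      (filter-all proper? rest-proper)

colour-trivial : ∀ {m} (i : Fin (suc m)) → colour (trivial m) i ≡ false
colour-trivial zero    = refl
colour-trivial (suc i) = lookup-replicate i false

Separating-trivial∷ : ∀ {m} → Separating ∘ (trivial m ∷_) ≐ Separating
Separating-trivial∷ = drop , add
  where
  drop : ∀ {m} {F : List (Bip m)} → Separating (trivial m ∷ F) → Separating F
  drop sep i j i≢j with sep i j i≢j
  ... | here cut = ⊥-elim (cut (trans (colour-trivial i) (sym (colour-trivial j))))
  ... | there F-cuts = F-cuts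

  add : ∀ {m} {F : List (Bip m)} → Separating F → Separating (trivial m ∷ F)
  add sep i j i≢j = there (sep i j i≢j)

τ-suc : ∀ m k → τ (suc m) (suc k) ≡ σ (suc m) k + σ (suc m) (suc k)
τ-suc m k = begin
  τ (suc m) (suc k)
    ≡⟨ cong (count ∘ choose (suc k)) (allBips≡trivial∷properBips m) ⟩
  count (withTrivial ++ withoutTrivial)
    ≡⟨ cong length (filter-++ separating? withTrivial withoutTrivial) ⟩
  length (filter separating? withTrivial ++ filter separating? withoutTrivial)
    ≡⟨ length-++ (filter separating? withTrivial) ⟩
  count withTrivial + σ (suc m) (suc k)
    ≡⟨ cong (_+ σ (suc m) (suc k))
            (length-filter-map separating? separating? (trivial m ∷_) Separating-trivial∷ (choose k (properBips m))) ⟩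
  σ (suc m) k + σ (suc m) (suc k) ∎
  where
  count : List (List (Bip m)) → ℕ
  count = length ∘ filter separating?

  withTrivial withoutTrivial : List (List (Bip m))
  withTrivial    = map (trivial m ∷_) (choose k (properBips m))
  withoutTrivial = choose (suc k) (properBips m)

lemma3p10 : ∀ (n k : ℕ) → 2 ≤ n → 2 ≤ k → k ≤ 2 ^ (n ∸ 1) →
    σ n k + σ n (k ∸ 1) ≡ τ n k
lemma3p10 (suc m) (suc k) _ _ _ = trans (+-comm (σ (suc m) (suc k)) (σ (suc m) k)) (sym (τ-suc m k))
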